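{- Let $G$ be a graph of order $n$ with exactly $f$ full vertices. Then $c(G)=1$ if and only if $\alpha(G)=n-f$.
   Context: All graphs are finite and simple. A full vertex is a vertex of degree $n-1$. $\alpha(G)$ is the independence number of $G$ (maximum size of a set of pairwise non-adjacent vertices). A set $S\subseteq V(G)$ is dominating if every vertex outside $S$ has a neighbor in $S$. A coalition consists of two disjoint vertex sets $V_1,V_2$, neither dominating, with $V_1\cup V_2$ dominating. A $c$-partition of $G$ is a partition $\pi=\{V_1,\dots,V_k\}$ of $V(G)$ such that every $V_i$ is either a singleton dominating set, or is not dominating but forms a coalition with some other set $V_j\in\pi$. The coalition count $c(G)$ is the maximum, over all $c$-partitions $\pi$ of $G$, of the number of unordered pairs $\{V_i,V_j\}$ of distinct sets of $\pi$ that form a coalition. -}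

module Defs where

open import Data.Nat using (ℕ; _≤_; _∸_)
open import Data.Nat as ℕ using ()
open import Data.Bool using (Bool; true; false; if_then_else_)
open import Data.Bool.Properties using () renaming (_≟_ to _≟ᵇ_)
open import Data.Fin using (Fin; _<_; _<?_)
open import Data.Fin.Properties using (any?; all?) renaming (_≟_ to _≟ᶠ_)
open import Data.Fin.Subset using (Subset; inside; outside; _∈_; _∉_; _∪_; ⁅_⁆; ∣_∣)
open import Data.Fin.Subset.Properties using (_∈?_)
open import Data.Vec using (tabulate)
open import Data.List using (List; length; filter; concatMap; map; allFin)
open import Data.Product using (Σ; ∃; ∃-syntax; _×_; _,_; proj₁; proj₂)
open import Data.Sum using (_⊎_)
open import Relation.Nullary using (¬_; Dec; yes; no; ¬?)
open import Relation.Nullary.Decidable using (⌊_⌋; _×-dec_; _→-dec_)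
open import Relation.Binary.PropositionalEquality using (_≡_; _≢_)

record Graph (n : ℕ) : Set where
  field
    adj   : Fin n → Fin n → Bool
    sym   : ∀ u v → adj u v ≡ adj v u
    irrefl : ∀ v → adj v v ≡ false
open Graph public

module _ {n : ℕ} (G : Graph n) where

  Adj : Fin n → Fin n → Set
  Adj u v = adj G u v ≡ true

  nbhd : Fin n → Subset n
  nbhd v = tabulate (λ u → if adj G v u then inside else outside)

  degree : Fin n → ℕ
  degree v = ∣ nbhd v ∣

  Full : Fin n → Set
  Full v = degree v ≡ n ∸ 1

  fullSet : Subset n
  fullSet = tabulate (λ v → if ⌊ degree v ℕ.≟ (n ∸ 1) ⌋ then inside else outside)

  numFull : ℕ
  numFull = ∣ fullSet ∣

  Independent : Subset n → Set
  Independent S = ∀ u v → u ∈ S → v ∈ S → adj G u v ≡ false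

  IsIndependenceNumber : ℕ → Set
  IsIndependenceNumber m =
    (∃[ S ] (Independent S × ∣ S ∣ ≡ m)) × (∀ S → Independent S → ∣ S ∣ ≤ m)

  Dominating : Subset n → Set
  Dominating S = ∀ v → v ∉ S → ∃[ u ] (u ∈ S × Adj u v)

  dominating? : (S : Subset n) → Dec (Dominating S)
  dominating? S = all? (λ v → ¬? (v ∈? S) →-dec any? (λ u → (u ∈? S) ×-dec (adj G u v ≟ᵇ true)))

  Disjoint : Subset n → Subset n → Set
  Disjoint A B = ∀ v → ¬ (v ∈ A × v ∈ B)

  disjoint? : (A B : Subset n) → Dec (Disjoint A B)
  disjoint? A B = all? (λ v → ¬? ((v ∈? A) ×-dec (v ∈? B)))

  Coalition : Subset n → Subset n → Set
  Coalition A B = Disjoint A B × ¬ Dominating A × ¬ Dominating B × Dominating (A ∪ B)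

  coalition? : (A B : Subset n) → Dec (Coalition A B)
  coalition? A B = disjoint? A B ×-dec ¬? (dominating? A) ×-dec ¬? (dominating? B)
                   ×-dec dominating? (A ∪ B)

record Partition (n : ℕ) : Set where
  field
    k       : ℕ
    part    : Fin n → Fin k
    nonempty : ∀ (i : Fin k) → ∃[ v ] (part v ≡ i)
open Partition public

block : ∀ {n} (π : Partition n) → Fin (k π) → Subset n
block π i = tabulate (λ v → if ⌊ part π v ≟ᶠ i ⌋ then inside else outside)

module _ {n : ℕ} (G : Graph n) where

  IsCPartition : Partition n → Set
  IsCPartition π = ∀ i →
      (∃[ v ] (block π i ≡ ⁅ v ⁆) × Dominating G (block π i))
    ⊎ (¬ Dominating G (block π i) × ∃[ j ] (j ≢ i × Coalition G (block π i) (block π j)))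

  coalitionPairs : (π : Partition n) → List (Fin (k π) × Fin (k π))
  coalitionPairs π =
    filter (λ p → (proj₁ p <? proj₂ p) ×-dec coalition? G (block π (proj₁ p)) (block π (proj₂ p)))
      (concatMap (λ i → map (λ j → (i , j)) (allFin (k π))) (allFin (k π)))

  coalitionCount : Partition n → ℕ
  coalitionCount π = length (coalitionPairs π)

  IsCoalitionNumber : ℕ → Set
  IsCoalitionNumber m =
      (∃[ π ] (IsCPartition π × coalitionCount π ≡ m))
    × (∀ π → IsCPartition π → coalitionCount π ≤ m)

{-# OPTIONS --safe #-}
module Submission where

-- Let W be the set of non-full vertices. Both sides say that W is a nonempty independent set.
-- For α: an independent set containing a full vertex is a singleton, and every other one lies inside W.
-- For c: the blocks of a coalition are non-dominating, so they lie inside W; if W is independent they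
-- must cover W, so every non-dominating block is one of them, all coalitions of a partition involve the
-- same two blocks, and c(G) ≤ 1, with equality for {W ∖ {w}, {w}} plus singletons. If instead W contains
-- an edge uy, move along such edges, shrinking the closed neighbourhood N[u], until S = V ∖ N[u] has the
-- property that S ∪ {v} dominates for every v ∉ S; then S together with singletons is a c-partition in
-- which S forms coalitions with both {u} and {y}.

open import Defs hiding (sym)
open import Data.Bool using (Bool; true; false; if_then_else_)
open import Data.Bool.Properties using (T-≡; ¬-not) renaming (_≟_ to _≟ᵇ_)
open import Data.Empty using (⊥-elim)
open import Data.Fin using (Fin; zero; suc; _<_; _<?_; fromℕ<)
open import Data.Fin.Properties using (any?; all?; ¬∀⟶∃¬; <-cmp; <-asym; suc-injective)
  renaming (_≟_ to _≟ᶠ_; <-irrefl to <ᶠ-irrefl)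
open import Data.Fin.Subset
  using (Subset; inside; outside; _∈_; _∉_; _∪_; ⁅_⁆; ∣_∣; _⊆_; ∁; Nonempty)
open import Data.Fin.Subset.Properties
  using ( _∈?_; x∈⁅x⁆; x∈⁅y⁆⇒x≡y; x≢y⇒x∉⁅y⁆; x∉⁅y⁆⇒x≢y; ∣⁅x⁆∣≡1; x∈p∪q⁻; x∈p∪q⁺; ∪-comm
        ; ⊆-antisym; p⊆q⇒∣p∣≤∣q∣; p⊂q⇒∣p∣<∣q∣; ∣∁p∣≡n∸∣p∣
        ; x∉p⇒x∈∁p; x∈∁p⇒x∉p; x∉∁p⇒x∈p; nonempty?; Empty-unique; ∣⊥∣≡0)
open import Data.List using (List; []; _∷_; length; concatMap; map; allFin; cartesianProduct; _++_)
open import Data.List.Membership.Propositional using () renaming (_∈_ to _∈ₗ_)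
open import Data.List.Membership.Propositional.Properties
  using (∈-filter⁺; ∈-filter⁻; ∈-allFin; ∈-cartesianProduct⁺; ∈-length)
open import Data.List.Relation.Unary.Any using (here; there)
open import Data.List.Relation.Unary.AllPairs using (_∷_)
open import Data.List.Relation.Unary.All using (_∷_)
open import Data.List.Relation.Unary.Unique.Propositional using (Unique)
open import Data.List.Relation.Unary.Unique.Propositional.Properties
  using (filter⁺; cartesianProduct⁺; allFin⁺)
open import Data.Maybe using (Maybe; nothing; just)
open import Data.Maybe.Properties using (just-injective) renaming (≡-dec to ≡-decMaybe)
open import Data.Nat using (ℕ; zero; suc; _≤_; _∸_; z≤n; s≤s) renaming (_<_ to _<ℕ_; _≟_ to _≟ℕ_)
open import Data.Nat.Induction using (<-wellFounded)
open import Data.Nat.Properties using (≤-antisym; ≤-trans; ≤⇒≯; <-irrefl)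
open import Data.Product using (∃-syntax; _×_; _,_; proj₁; proj₂)
open import Data.Sum using (_⊎_; inj₁; inj₂; [_,_]′)
open import Data.Vec using (tabulate; lookup)
open import Data.Vec.Properties using (lookup∘tabulate; []=⇒lookup; lookup⇒[]=)
open import Function using (_∘_)
open import Function.Bundles using (_⇔_; mk⇔; Equivalence)
open import Function.Properties.Equivalence using () renaming (trans to ⇔-trans; sym to ⇔-sym)
open import Induction.WellFounded using (Acc; acc)
open import Relation.Binary.Definitions using (DecidableEquality; tri<; tri≈; tri>)
open import Relation.Binary.PropositionalEquality using (_≡_; _≢_; refl; sym; trans; cong; subst; subst₂)
open import Relation.Nullary using (¬_; Dec; yes; no; ¬?; contradiction)
open import Relation.Nullary.Decidable using (⌊_⌋; _×-dec_; _→-dec_; toWitness; dec-true; isYes≗does)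
open import Relation.Unary using (Decidable)

open Equivalence using (to; from)

≡true⇒≢false : ∀ {b : Bool} → b ≡ true → b ≢ false
≡true⇒≢false refl ()

if-inside-outside : ∀ b → (if b then inside else outside) ≡ b
if-inside-outside true  = refl
if-inside-outside false = refl

∈-tabulate⇔ : ∀ {n} (b : Fin n → Bool) {x} →
              x ∈ tabulate (λ u → if b u then inside else outside) ⇔ b x ≡ true
∈-tabulate⇔ b {x} =
  mk⇔ (λ x∈ → trans (sym lookup≡) ([]=⇒lookup x∈)) (λ bx → lookup⇒[]= x _ (trans lookup≡ bx))
  where
  lookup≡ : lookup (tabulate (λ u → if b u then inside else outside)) x ≡ b x
  lookup≡ = trans (lookup∘tabulate _ x) (if-inside-outside (b x))

∈-decTabulate⇔ : ∀ {n} {P : Fin n → Set} (P? : Decidable P) {x} →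
                 x ∈ tabulate (λ u → if ⌊ P? u ⌋ then inside else outside) ⇔ P x
∈-decTabulate⇔ P? {x} = mk⇔
  (λ x∈ → toWitness (from T-≡ (to (∈-tabulate⇔ _) x∈)))
  (λ px → from (∈-tabulate⇔ _) (trans (isYes≗does (P? x)) (dec-true (P? x) px)))

x∈p⇒⁅x⁆⊆p : ∀ {n} {x : Fin n} {p} → x ∈ p → ⁅ x ⁆ ⊆ p
x∈p⇒⁅x⁆⊆p {x = x} {p} x∈p y∈⁅x⁆ = subst (_∈ p) (sym (x∈⁅y⁆⇒x≡y x y∈⁅x⁆)) x∈p

x∈p⇒1≤∣p∣ : ∀ {n} {x : Fin n} {p} → x ∈ p → 1 ≤ ∣ p ∣
x∈p⇒1≤∣p∣ {x = x} x∈p = subst (_≤ _) (∣⁅x⁆∣≡1 x) (p⊆q⇒∣p∣≤∣q∣ (x∈p⇒⁅x⁆⊆p x∈p))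

p⊆⁅x⁆⇒∣p∣≤1 : ∀ {n} {x : Fin n} {p} → p ⊆ ⁅ x ⁆ → ∣ p ∣ ≤ 1
p⊆⁅x⁆⇒∣p∣≤1 {x = x} p⊆⁅x⁆ = subst (_ ≤_) (∣⁅x⁆∣≡1 x) (p⊆q⇒∣p∣≤∣q∣ p⊆⁅x⁆)

x∈p∧y∈p∧x≢y⇒2≤∣p∣ : ∀ {n} {x y : Fin n} {p} → x ∈ p → y ∈ p → y ≢ x → 2 ≤ ∣ p ∣
x∈p∧y∈p∧x≢y⇒2≤∣p∣ {x = x} x∈p y∈p y≢x =
  subst (_<ℕ _) (∣⁅x⁆∣≡1 x) (p⊂q⇒∣p∣<∣q∣ (x∈p⇒⁅x⁆⊆p x∈p , _ , y∈p , x≢y⇒x∉⁅y⁆ y≢x))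

1≤∣p∣⇒Nonempty : ∀ {n} (p : Subset n) → 1 ≤ ∣ p ∣ → Nonempty p
1≤∣p∣⇒Nonempty {n} p 1≤∣p∣ with nonempty? p
... | yes ne = ne
... | no empty with () ← subst (1 ≤_) (trans (cong ∣_∣ (Empty-unique empty)) (∣⊥∣≡0 n)) 1≤∣p∣

module _ {A : Set} where

  ∈-length⇒member : (xs : List A) → 1 ≤ length xs → ∃[ x ] (x ∈ₗ xs)
  ∈-length⇒member (x ∷ _) _ = x , here refl

  two-∈⇒2≤length : ∀ {x y} (xs : List A) → x ∈ₗ xs → y ∈ₗ xs → x ≢ y → 2 ≤ length xs
  two-∈⇒2≤length (_ ∷ [])    (here refl) (here refl) x≢y = ⊥-elim (x≢y refl)
  two-∈⇒2≤length (_ ∷ _ ∷ _) _           _           _   = s≤s (s≤s z≤n)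

  unique-constant⇒length≤1 : (xs : List A) → Unique xs → (∀ {x y} → x ∈ₗ xs → y ∈ₗ xs → x ≡ y) →
                             length xs ≤ 1
  unique-constant⇒length≤1 []          _             _     = z≤n
  unique-constant⇒length≤1 (_ ∷ [])    _             _     = s≤s z≤n
  unique-constant⇒length≤1 (_ ∷ _ ∷ _) ((x∉ ∷ _) ∷ _) const =
    ⊥-elim (x∉ (const (here refl) (there (here refl))))

  module _ {B : Set} where

    concatMap≡cartesianProduct : (xs : List A) (ys : List B) →
                                 concatMap (λ x → map (λ y → (x , y)) ys) xs ≡ cartesianProduct xs ys
    concatMap≡cartesianProduct []       ys = refl
    concatMap≡cartesianProduct (x ∷ xs) ys =
      cong (map (λ y → (x , y)) ys ++_) (concatMap≡cartesianProduct xs ys)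

record FibreIndexing {n : ℕ} {A : Set} (g : Fin n → A) : Set where
  field
    size             : ℕ
    index            : Fin n → Fin size
    index-surjective : ∀ i → ∃[ v ] (index v ≡ i)
    index-sound      : ∀ {u v} → index u ≡ index v → g u ≡ g v
    index-complete   : ∀ {u v} → g u ≡ g v → index u ≡ index v

module _ {A : Set} {n : ℕ} {g : Fin (suc n) → A} (I : FibreIndexing (g ∘ suc)) where
  open FibreIndexing I

  extendByOldFibre : ∃[ w ] (g zero ≡ g (suc w)) → FibreIndexing g
  extendByOldFibre (w , g0≡gw) = record
    { size = size ; index = index′ ; index-surjective = surjective′
    ; index-sound = sound′ ; index-complete = complete′ }
    where
    index′ : Fin (suc n) → Fin size
    index′ zero    = index w
    index′ (suc v) = index v
    surjective′ : ∀ i → ∃[ v ] (index′ v ≡ i)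
    surjective′ i with v , e ← index-surjective i = suc v , e
    sound′ : ∀ {u v} → index′ u ≡ index′ v → g u ≡ g v
    sound′ {zero}  {zero}  _ = refl
    sound′ {zero}  {suc v} e = trans g0≡gw (index-sound e)
    sound′ {suc u} {zero}  e = trans (index-sound e) (sym g0≡gw)
    sound′ {suc u} {suc v} e = index-sound e
    complete′ : ∀ {u v} → g u ≡ g v → index′ u ≡ index′ v
    complete′ {zero}  {zero}  _ = refl
    complete′ {zero}  {suc v} e = index-complete (trans (sym g0≡gw) e)
    complete′ {suc u} {zero}  e = index-complete (trans e g0≡gw)
    complete′ {suc u} {suc v} e = index-complete e

  extendByNewFibre : (∀ w → g zero ≢ g (suc w)) → FibreIndexing g
  extendByNewFibre fresh = record
    { size = suc size ; index = index′ ; index-surjective = surjective′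
    ; index-sound = sound′ ; index-complete = complete′ }
    where
    index′ : Fin (suc n) → Fin (suc size)
    index′ zero    = zero
    index′ (suc v) = suc (index v)
    surjective′ : ∀ i → ∃[ v ] (index′ v ≡ i)
    surjective′ zero = zero , refl
    surjective′ (suc i) with v , e ← index-surjective i = suc v , cong suc e
    sound′ : ∀ {u v} → index′ u ≡ index′ v → g u ≡ g v
    sound′ {zero}  {zero}  _ = refl
    sound′ {suc u} {suc v} e = index-sound (suc-injective e)
    complete′ : ∀ {u v} → g u ≡ g v → index′ u ≡ index′ v
    complete′ {zero}  {zero}  _ = refl
    complete′ {zero}  {suc v} e = ⊥-elim (fresh v e)
    complete′ {suc u} {zero}  e = ⊥-elim (fresh u (sym e))
    complete′ {suc u} {suc v} e = cong suc (index-complete e)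

fibreIndexing : ∀ {A : Set} → DecidableEquality A → ∀ n (g : Fin n → A) → FibreIndexing g
fibreIndexing _≟_ zero    g = record
  { size = 0 ; index = λ () ; index-surjective = λ () ; index-sound = λ {} ; index-complete = λ {} }
fibreIndexing _≟_ (suc n) g with any? (λ w → g zero ≟ g (suc w))
... | yes old = extendByOldFibre (fibreIndexing _≟_ n (g ∘ suc)) old
... | no ¬old = extendByNewFibre (fibreIndexing _≟_ n (g ∘ suc)) (λ w e → ¬old (w , e))

fibrePartition : ∀ {n} {A : Set} {g : Fin n → A} → FibreIndexing g → Partition n
fibrePartition I = record { k = size ; part = index ; nonempty = index-surjective }
  where open FibreIndexing I

∈block⇔ : ∀ {n} (π : Partition n) {i x} → x ∈ block π i ⇔ part π x ≡ i
∈block⇔ π {i} = ∈-decTabulate⇔ (λ v → part π v ≟ᶠ i)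

module BlockWithSingletons {n : ℕ} (S : Subset n) where

  label : Fin n → Maybe (Fin n)
  label x = if ⌊ x ∈? S ⌋ then nothing else just x

  label-∈ : ∀ {x} → x ∈ S → label x ≡ nothing
  label-∈ {x} x∈S with x ∈? S
  ... | yes _   = refl
  ... | no x∉S = contradiction x∈S x∉S

  label-∉ : ∀ {x} → x ∉ S → label x ≡ just x
  label-∉ {x} x∉S with x ∈? S
  ... | yes x∈S = contradiction x∈S x∉S
  ... | no _    = refl

  label≡nothing⇒∈ : ∀ {x} → label x ≡ nothing → x ∈ S
  label≡nothing⇒∈ {x} e with x ∈? S
  ... | yes x∈S = x∈S

  label≡just⇒≡ : ∀ {x y} → label x ≡ just y → x ≡ y
  label≡just⇒≡ {x} e with x ∈? S
  ... | no _ = just-injective e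

  indexing : FibreIndexing label
  indexing = fibreIndexing (≡-decMaybe _≟ᶠ_) n label

  open FibreIndexing indexing public using (index; index-surjective)
  open FibreIndexing indexing using (index-sound; index-complete)

  partition : Partition n
  partition = fibrePartition indexing

  ∈block⇔sameLabel : ∀ {x v} → x ∈ block partition (index v) ⇔ label x ≡ label v
  ∈block⇔sameLabel =
    mk⇔ (index-sound ∘ to (∈block⇔ partition)) (from (∈block⇔ partition) ∘ index-complete)

  block-∈ : ∀ {s} → s ∈ S → block partition (index s) ≡ S
  block-∈ s∈S = ⊆-antisym
    (λ x∈ → label≡nothing⇒∈ (trans (to ∈block⇔sameLabel x∈) (label-∈ s∈S)))
    (λ x∈S → from ∈block⇔sameLabel (trans (label-∈ x∈S) (sym (label-∈ s∈S))))

  block-∉ : ∀ {v} → v ∉ S → block partition (index v) ≡ ⁅ v ⁆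
  block-∉ {v} v∉S = ⊆-antisym
    (λ x∈ → subst (_∈ ⁅ v ⁆) (sym (label≡just⇒≡ (trans (to ∈block⇔sameLabel x∈) (label-∉ v∉S))))
                 (x∈⁅x⁆ v))
    (λ x∈⁅v⁆ → from ∈block⇔sameLabel (cong label (x∈⁅y⁆⇒x≡y v x∈⁅v⁆)))

  index-∈≢∉ : ∀ {s v} → s ∈ S → v ∉ S → index s ≢ index v
  index-∈≢∉ s∈S v∉S e with () ← trans (sym (label-∈ s∈S)) (trans (index-sound e) (label-∉ v∉S))

  index-∉-injective : ∀ {u v} → u ∉ S → v ∉ S → index u ≡ index v → u ≡ v
  index-∉-injective u∉S v∉S e =
    just-injective (trans (sym (label-∉ u∉S)) (trans (index-sound e) (label-∉ v∉S)))

module _ {n : ℕ} (G : Graph n) where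

  nonFull : Subset n
  nonFull = ∁ (fullSet G)

  adj-sym : ∀ {u v} → Adj G u v → Adj G v u
  adj-sym {u} {v} a = trans (Graph.sym G v u) a

  nonAdj-sym : ∀ {u v} → adj G u v ≡ false → adj G v u ≡ false
  nonAdj-sym {u} {v} na = trans (Graph.sym G v u) na

  ∈nbhd⇔ : ∀ {v x} → x ∈ nbhd G v ⇔ Adj G v x
  ∈nbhd⇔ {v} = ∈-tabulate⇔ (adj G v)

  ∈fullSet⇔ : ∀ {v} → v ∈ fullSet G ⇔ Full G v
  ∈fullSet⇔ = ∈-decTabulate⇔ (λ v → degree G v ≟ℕ (n ∸ 1))

  nbhd⊆∁⁅⁆ : ∀ v → nbhd G v ⊆ ∁ ⁅ v ⁆
  nbhd⊆∁⁅⁆ v {x} x∈N = x∉p⇒x∈∁p (λ x∈⁅v⁆ → loopless (x∈⁅y⁆⇒x≡y v x∈⁅v⁆) (to ∈nbhd⇔ x∈N))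
    where
    loopless : x ≡ v → Adj G v x → _
    loopless refl a = ≡true⇒≢false a (irrefl G v)

  ∣∁⁅v⁆∣≡n∸1 : ∀ v → ∣ ∁ ⁅ v ⁆ ∣ ≡ n ∸ 1
  ∣∁⁅v⁆∣≡n∸1 v = trans (∣∁p∣≡n∸∣p∣ ⁅ v ⁆) (cong (n ∸_) (∣⁅x⁆∣≡1 v))

  full⇒adj : ∀ {v u} → v ∈ fullSet G → u ≢ v → Adj G v u
  full⇒adj {v} {u} v∈F u≢v = ¬-not λ na → <-irrefl degree≡ (p⊂q⇒∣p∣<∣q∣
    (nbhd⊆∁⁅⁆ v , u , x∉p⇒x∈∁p (x≢y⇒x∉⁅y⁆ u≢v) , λ u∈N → ≡true⇒≢false (to ∈nbhd⇔ u∈N) na))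
    where
    degree≡ : ∣ nbhd G v ∣ ≡ ∣ ∁ ⁅ v ⁆ ∣
    degree≡ = trans (to ∈fullSet⇔ v∈F) (sym (∣∁⁅v⁆∣≡n∸1 v))

  adjToAll⇒full : ∀ {v} → (∀ u → u ≢ v → Adj G v u) → v ∈ fullSet G
  adjToAll⇒full {v} adjToAll = from ∈fullSet⇔
    (trans (≤-antisym (p⊆q⇒∣p∣≤∣q∣ (nbhd⊆∁⁅⁆ v)) (p⊆q⇒∣p∣≤∣q∣ ∁⁅v⁆⊆N)) (∣∁⁅v⁆∣≡n∸1 v))
    where
    ∁⁅v⁆⊆N : ∁ ⁅ v ⁆ ⊆ nbhd G v
    ∁⁅v⁆⊆N {u} u∈ = from ∈nbhd⇔ (adjToAll u (x∉⁅y⁆⇒x≢y (x∈∁p⇒x∉p u∈)))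

  nonFull⇒nonNeighbour : ∀ {v} → v ∉ fullSet G → ∃[ u ] (u ≢ v × adj G v u ≡ false)
  nonFull⇒nonNeighbour {v} v∉F with any? (λ u → ¬? (u ≟ᶠ v) ×-dec (adj G v u ≟ᵇ false))
  ... | yes nonNeighbour = nonNeighbour
  ... | no ¬nonNeighbour =
    contradiction (adjToAll⇒full λ u u≢v → ¬-not λ na → ¬nonNeighbour (u , u≢v , na)) v∉F

  nonNeighbour⇒nonFull : ∀ {u v} → u ≢ v → adj G v u ≡ false → u ∉ fullSet G
  nonNeighbour⇒nonFull u≢v na u∈F = ≡true⇒≢false (adj-sym (full⇒adj u∈F (u≢v ∘ sym))) na

  full⇒dominating : ∀ {B v} → v ∈ B → v ∈ fullSet G → Dominating G B
  full⇒dominating {B} v∈B v∈F x x∉B =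
    _ , v∈B , full⇒adj v∈F (λ x≡v → x∉B (subst (_∈ B) (sym x≡v) v∈B))

  nonDominating⇒nonFull : ∀ {B v} → ¬ Dominating G B → v ∈ B → v ∉ fullSet G
  nonDominating⇒nonFull ¬dom v∈B v∈F = ¬dom (full⇒dominating v∈B v∈F)

  undominated⇒nonDominating : ∀ {B x} → x ∉ B → (∀ z → z ∈ B → adj G z x ≡ false) → ¬ Dominating G B
  undominated⇒nonDominating x∉B undominated dom with z , z∈B , zx ← dom _ x∉B =
    ≡true⇒≢false zx (undominated z z∈B)

  dominatedIfOutside? : ∀ B v → Dec (v ∉ B → ∃[ u ] (u ∈ B × Adj G u v))
  dominatedIfOutside? B v = ¬? (v ∈? B) →-dec any? (λ u → (u ∈? B) ×-dec (adj G u v ≟ᵇ true))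

  nonDominating⇒undominated : ∀ {B} → ¬ Dominating G B →
                              ∃[ x ] (x ∉ B × (∀ z → z ∈ B → adj G z x ≡ false))
  nonDominating⇒undominated {B} ¬dom
    with x , ¬dominated ← ¬∀⟶∃¬ n _ (dominatedIfOutside? B) ¬dom
    = x , (λ x∈B → ¬dominated (λ x∉B → contradiction x∈B x∉B))
        , (λ z z∈B → ¬-not λ zx → ¬dominated (λ _ → z , z∈B , zx))

  nonFull⇒¬Dominating⁅⁆ : ∀ {v} → v ∉ fullSet G → ¬ Dominating G ⁅ v ⁆
  nonFull⇒¬Dominating⁅⁆ {v} v∉F with u , u≢v , na ← nonFull⇒nonNeighbour v∉F =
    undominated⇒nonDominating (x≢y⇒x∉⁅y⁆ u≢v)
      (λ z z∈⁅v⁆ → subst (λ z → adj G z u ≡ false) (sym (x∈⁅y⁆⇒x≡y v z∈⁅v⁆)) na)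

  ⁅⁆-independent : ∀ v → Independent G ⁅ v ⁆
  ⁅⁆-independent v a b a∈ b∈ rewrite x∈⁅y⁆⇒x≡y v a∈ | x∈⁅y⁆⇒x≡y v b∈ = irrefl G v

  independent-full⇒⊆⁅⁆ : ∀ {T z} → Independent G T → z ∈ T → z ∈ fullSet G → T ⊆ ⁅ z ⁆
  independent-full⇒⊆⁅⁆ {z = z} indT z∈T z∈F {x} x∈T with x ≟ᶠ z
  ... | yes refl = x∈⁅x⁆ x
  ... | no x≢z  = ⊥-elim (≡true⇒≢false (full⇒adj z∈F x≢z) (indT z x z∈T x∈T))

  independent⇒⊆⁅⁆⊎⊆nonFull : ∀ {T} → Independent G T → (∃[ z ] (T ⊆ ⁅ z ⁆)) ⊎ T ⊆ nonFull
  independent⇒⊆⁅⁆⊎⊆nonFull {T} indT with any? (λ z → (z ∈? T) ×-dec (z ∈? fullSet G))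
  ... | yes (z , z∈T , z∈F) = inj₁ (z , independent-full⇒⊆⁅⁆ indT z∈T z∈F)
  ... | no ¬full            = inj₂ (λ x∈T → x∉p⇒x∈∁p (λ x∈F → ¬full (_ , x∈T , x∈F)))

  coalition-sym : ∀ {A B} → Coalition G A B → Coalition G B A
  coalition-sym {A} {B} (disjoint , ¬domA , ¬domB , dom) =
    (λ v (v∈B , v∈A) → disjoint v (v∈A , v∈B)) , ¬domB , ¬domA , subst (Dominating G) (∪-comm A B) dom

  coalition-with-⁅⁆ : ∀ {S v} → v ∉ S → v ∉ fullSet G → ¬ Dominating G S → Dominating G (S ∪ ⁅ v ⁆) →
                      Coalition G S ⁅ v ⁆
  coalition-with-⁅⁆ {S} {v} v∉S v∉F ¬domS dom =
    (λ x (x∈S , x∈⁅v⁆) → v∉S (subst (_∈ S) (x∈⁅y⁆⇒x≡y v x∈⁅v⁆) x∈S))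
    , ¬domS , nonFull⇒¬Dominating⁅⁆ v∉F , dom

  module _ (π : Partition n) where

    private
      isCoalitionPair? : (p : Fin (k π) × Fin (k π)) → Dec _
      isCoalitionPair? p = (proj₁ p <? proj₂ p) ×-dec coalition? G (block π (proj₁ p)) (block π (proj₂ p))

      allPairs≡ : concatMap (λ i → map (λ j → (i , j)) (allFin (k π))) (allFin (k π))
                ≡ cartesianProduct (allFin (k π)) (allFin (k π))
      allPairs≡ = concatMap≡cartesianProduct (allFin (k π)) (allFin (k π))

      listed : ∀ a b → (a , b) ∈ₗ concatMap (λ i → map (λ j → (i , j)) (allFin (k π))) (allFin (k π))
      listed a b = subst ((a , b) ∈ₗ_) (sym allPairs≡) (∈-cartesianProduct⁺ (∈-allFin a) (∈-allFin b))

    coalitionPartner : ∀ {i j} → j ≢ i → Coalition G (block π i) (block π j) →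
                       ¬ Dominating G (block π i) × ∃[ j ] (j ≢ i × Coalition G (block π i) (block π j))
    coalitionPartner j≢i coal = proj₁ (proj₂ coal) , _ , j≢i , coal

    coalitionPairs-sound : ∀ {p} → p ∈ₗ coalitionPairs G π →
                           proj₁ p < proj₂ p × Coalition G (block π (proj₁ p)) (block π (proj₂ p))
    coalitionPairs-sound p∈ = proj₂ (∈-filter⁻ isCoalitionPair? {xs = concatMap _ (allFin (k π))} p∈)

    coalitionPairs-complete : ∀ {i j} → i ≢ j → Coalition G (block π i) (block π j) →
                              ∃[ p ] (p ∈ₗ coalitionPairs G π × (p ≡ (i , j) ⊎ p ≡ (j , i)))
    coalitionPairs-complete {i} {j} i≢j coal with <-cmp i j
    ... | tri< i<j _ _ = (i , j) , ∈-filter⁺ isCoalitionPair? (listed i j) (i<j , coal) , inj₁ refl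
    ... | tri≈ _ i≡j _ = contradiction i≡j i≢j
    ... | tri> _ _ j<i =
      (j , i) , ∈-filter⁺ isCoalitionPair? (listed j i) (j<i , coalition-sym coal) , inj₂ refl

    coalitionPairs-unique : Unique (coalitionPairs G π)
    coalitionPairs-unique = filter⁺ isCoalitionPair?
      (subst Unique (sym allPairs≡) (cartesianProduct⁺ (allFin⁺ (k π)) (allFin⁺ (k π))))

    coalitionCount≥1 : ∀ {i j} → i ≢ j → Coalition G (block π i) (block π j) → 1 ≤ coalitionCount G π
    coalitionCount≥1 i≢j coal = ∈-length (proj₁ (proj₂ (coalitionPairs-complete i≢j coal)))

    coalitionCount≥2 : ∀ {i j j′} → i ≢ j → i ≢ j′ → j ≢ j′ →
                       Coalition G (block π i) (block π j) → Coalition G (block π i) (block π j′) →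
                       2 ≤ coalitionCount G π
    coalitionCount≥2 {i} {j} {j′} i≢j i≢j′ j≢j′ coal coal′
      with p , p∈ , p-ends ← coalitionPairs-complete i≢j coal
         | q , q∈ , q-ends ← coalitionPairs-complete i≢j′ coal′
      = two-∈⇒2≤length (coalitionPairs G π) p∈ q∈ (differentEnds p-ends q-ends)
      where
      differentEnds : ∀ {p q} → (p ≡ (i , j) ⊎ p ≡ (j , i)) → (q ≡ (i , j′) ⊎ q ≡ (j′ , i)) → p ≢ q
      differentEnds (inj₁ refl) (inj₁ refl) e = j≢j′ (cong proj₂ e)
      differentEnds (inj₁ refl) (inj₂ refl) e = i≢j′ (cong proj₁ e)
      differentEnds (inj₂ refl) (inj₁ refl) e = i≢j (sym (cong proj₁ e))
      differentEnds (inj₂ refl) (inj₂ refl) e = j≢j′ (cong proj₁ e)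

  independentNonFull⇒nonAdj : Independent G nonFull → ∀ {u v} → u ∉ fullSet G → v ∉ fullSet G →
                              adj G u v ≡ false
  independentNonFull⇒nonAdj ind u∉F v∉F = ind _ _ (x∉p⇒x∈∁p u∉F) (x∉p⇒x∈∁p v∉F)

  coalition-covers-nonFull : Independent G nonFull → ∀ {A B} → Coalition G A B →
                             ∀ {x} → x ∉ fullSet G → x ∈ A ∪ B
  coalition-covers-nonFull ind {A} {B} (_ , ¬domA , ¬domB , dom) {x} x∉F with x ∈? A ∪ B
  ... | yes x∈ = x∈
  ... | no x∉ with z , z∈ , zx ← dom x x∉ =
    ⊥-elim (≡true⇒≢false zx (independentNonFull⇒nonAdj ind z∉F x∉F))
    where
    z∉F : z ∉ fullSet G
    z∉F = [ nonDominating⇒nonFull ¬domA , nonDominating⇒nonFull ¬domB ]′ (x∈p∪q⁻ A B z∈)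

  coalition-contains-nonDominatingBlocks : Independent G nonFull → (π : Partition n) →
                                          ∀ {i j} → Coalition G (block π i) (block π j) →
                                          ∀ {l} → ¬ Dominating G (block π l) → l ≡ i ⊎ l ≡ j
  coalition-contains-nonDominatingBlocks ind π {i} {j} coal {l} ¬dom
    with v , v↦l ← nonempty π l
    with x∈p∪q⁻ (block π i) (block π j)
           (coalition-covers-nonFull ind coal (nonDominating⇒nonFull ¬dom (from (∈block⇔ π) v↦l)))
  ... | inj₁ v∈i = inj₁ (trans (sym v↦l) (to (∈block⇔ π) v∈i))
  ... | inj₂ v∈j = inj₂ (trans (sym v↦l) (to (∈block⇔ π) v∈j))

  coalitionCount≤1 : Independent G nonFull → (π : Partition n) → coalitionCount G π ≤ 1
  coalitionCount≤1 ind π = unique-constant⇒length≤1 (coalitionPairs G π) (coalitionPairs-unique π) samePair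
    where
    samePair : ∀ {p q} → p ∈ₗ coalitionPairs G π → q ∈ₗ coalitionPairs G π → p ≡ q
    samePair {i , j} {i′ , j′} p∈ q∈
      with i<j , coal ← coalitionPairs-sound π p∈
         | i′<j′ , (_ , ¬domi′ , ¬domj′ , _) ← coalitionPairs-sound π q∈
      with coalition-contains-nonDominatingBlocks ind π coal ¬domi′
         | coalition-contains-nonDominatingBlocks ind π coal ¬domj′
    ... | inj₁ refl | inj₁ refl = contradiction i′<j′ (<ᶠ-irrefl refl)
    ... | inj₁ refl | inj₂ refl = refl
    ... | inj₂ refl | inj₁ refl = contradiction i′<j′ (<-asym i<j)
    ... | inj₂ refl | inj₂ refl = contradiction i′<j′ (<ᶠ-irrefl refl)

  module _ {S : Subset n} where
    open BlockWithSingletons S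

    blockWithSingletons-coalition : ∀ {s v} → s ∈ S → v ∉ S → Coalition G S ⁅ v ⁆ →
                                    Coalition G (block partition (index s)) (block partition (index v))
    blockWithSingletons-coalition s∈S v∉S = subst₂ (Coalition G) (sym (block-∈ s∈S)) (sym (block-∉ v∉S))

    blockWithSingletons-isCPartition : ∀ {s p} → s ∈ S → p ∉ S → p ∉ fullSet G →
                                       (∀ {v} → v ∉ S → v ∉ fullSet G → Coalition G S ⁅ v ⁆) →
                                       IsCPartition G partition
    blockWithSingletons-isCPartition {s} {p} s∈S p∉S p∉F coalition i
      with v , refl ← index-surjective i | v ∈? S | v ∈? fullSet G
    ... | yes v∈S | _      = inj₂ (coalitionPartner partition (index-∈≢∉ v∈S p∉S ∘ sym)
                                           (blockWithSingletons-coalition v∈S p∉S (coalition p∉S p∉F)))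
    ... | no v∉S | yes v∈F = inj₁ (v , block-∉ v∉S ,
                                   subst (Dominating G) (sym (block-∉ v∉S)) (full⇒dominating (x∈⁅x⁆ v) v∈F))
    ... | no v∉S | no v∉F  = inj₂ (coalitionPartner partition (index-∈≢∉ s∈S v∉S) (coalition-sym
                                   (blockWithSingletons-coalition s∈S v∉S (coalition v∉S v∉F))))

  closedNbhd : Fin n → Subset n
  closedNbhd v = ⁅ v ⁆ ∪ nbhd G v

  nonNbhd : Fin n → Subset n
  nonNbhd v = ∁ (closedNbhd v)

  ∈closedNbhd⁺ : ∀ {v x} → x ≡ v ⊎ Adj G v x → x ∈ closedNbhd v
  ∈closedNbhd⁺ (inj₁ refl) = x∈p∪q⁺ (inj₁ (x∈⁅x⁆ _))
  ∈closedNbhd⁺ (inj₂ vx)   = x∈p∪q⁺ (inj₂ (from ∈nbhd⇔ vx))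

  ∈closedNbhd⁻ : ∀ {v x} → x ∈ closedNbhd v → x ≡ v ⊎ Adj G v x
  ∈closedNbhd⁻ {v} x∈ with x∈p∪q⁻ ⁅ v ⁆ (nbhd G v) x∈
  ... | inj₁ x∈⁅v⁆ = inj₁ (x∈⁅y⁆⇒x≡y v x∈⁅v⁆)
  ... | inj₂ x∈N   = inj₂ (to ∈nbhd⇔ x∈N)

  ∈nonNbhd⁺ : ∀ {v x} → x ≢ v → adj G v x ≡ false → x ∈ nonNbhd v
  ∈nonNbhd⁺ x≢v na = x∉p⇒x∈∁p (λ x∈ → [ x≢v , (λ vx → ≡true⇒≢false vx na) ]′ (∈closedNbhd⁻ x∈))

  ∈nonNbhd⁻ : ∀ {v x} → x ∈ nonNbhd v → x ≢ v × adj G v x ≡ false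
  ∈nonNbhd⁻ {v} {x} x∈ = (λ x≡v → x∉ (∈closedNbhd⁺ (inj₁ x≡v))) , ¬-not (λ vx → x∉ (∈closedNbhd⁺ (inj₂ vx)))
    where
    x∉ : x ∉ closedNbhd v
    x∉ = x∈∁p⇒x∉p x∈

  ∉nonNbhd⇒adj : ∀ {v x} → x ≢ v → x ∉ nonNbhd v → Adj G v x
  ∉nonNbhd⇒adj x≢v x∉ = ¬-not (x∉ ∘ ∈nonNbhd⁺ x≢v)

  closedNbhd-⊆ : ∀ {u x} → x ∈ closedNbhd u → (∀ z → z ∈ nonNbhd u → adj G z x ≡ false) →
                 closedNbhd x ⊆ closedNbhd u
  closedNbhd-⊆ {u} {x} x∈ noNonNeighbourAdj {z} z∈ with ∈closedNbhd⁻ z∈ | z ∈? closedNbhd u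
  ... | inj₁ refl | _      = x∈
  ... | inj₂ _    | yes z∈′ = z∈′
  ... | inj₂ xz   | no z∉  = ⊥-elim (≡true⇒≢false (adj-sym xz) (noNonNeighbourAdj z (x∉p⇒x∈∁p z∉)))

  ExtensionsDominate : Subset n → Set
  ExtensionsDominate S = ∀ v → v ∉ S → Dominating G (S ∪ ⁅ v ⁆)

  extensionDominates? : ∀ S v → Dec (v ∉ S → Dominating G (S ∪ ⁅ v ⁆))
  extensionDominates? S v = ¬? (v ∈? S) →-dec dominating? G (S ∪ ⁅ v ⁆)

  -- If nonNbhd u ∪ {v} leaves x undominated, then N[x] ⊆ N[u] while v ∈ N[u] ∖ N[x].
  nonExtension⇒smallerNeighbour : ∀ {u} → ¬ ExtensionsDominate (nonNbhd u) →
                                  ∃[ x ] (x ∉ fullSet G × Adj G x u × ∣ closedNbhd x ∣ <ℕ ∣ closedNbhd u ∣)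
  nonExtension⇒smallerNeighbour {u} ¬ext
    with v , ¬domExtension ← ¬∀⟶∃¬ n _ (extensionDominates? (nonNbhd u)) ¬ext
    with x , x∉ , undominated ← nonDominating⇒undominated (λ dom → ¬domExtension (λ _ → dom))
    = x , nonNeighbour⇒nonFull x≢v vx , adj-sym ux , p⊂q⇒∣p∣<∣q∣ (N[x]⊆N[u] , v , v∈N[u] , v∉N[x])
    where
    v∉S : v ∉ nonNbhd u
    v∉S v∈S = ¬domExtension (λ v∉S → contradiction v∈S v∉S)
    x∉S : x ∉ nonNbhd u
    x∉S = x∉ ∘ x∈p∪q⁺ ∘ inj₁
    x≢v : x ≢ v
    x≢v x≡v = x∉ (x∈p∪q⁺ (inj₂ (subst (_∈ ⁅ v ⁆) (sym x≡v) (x∈⁅x⁆ v))))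
    vx : adj G v x ≡ false
    vx = undominated v (x∈p∪q⁺ (inj₂ (x∈⁅x⁆ v)))
    v∈N[u] : v ∈ closedNbhd u
    v∈N[u] = x∉∁p⇒x∈p v∉S
    v∉N[x] : v ∉ closedNbhd x
    v∉N[x] v∈ = [ x≢v ∘ sym , (λ xv → ≡true⇒≢false xv (nonAdj-sym vx)) ]′ (∈closedNbhd⁻ v∈)
    x≢u : x ≢ u
    x≢u refl = v∉N[x] v∈N[u]
    ux : Adj G u x
    ux = ∉nonNbhd⇒adj x≢u x∉S
    N[x]⊆N[u] : closedNbhd x ⊆ closedNbhd u
    N[x]⊆N[u] = closedNbhd-⊆ (∈closedNbhd⁺ (inj₂ ux)) (λ z z∈S → undominated z (x∈p∪q⁺ (inj₁ z∈S)))

  extensionsDominate⇒coalitionCount≥2 : ∀ {u y} → u ∉ fullSet G → y ∉ fullSet G → Adj G u y →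
                                        ExtensionsDominate (nonNbhd u) →
                                        ∃[ π ] (IsCPartition G π × 2 ≤ coalitionCount G π)
  extensionsDominate⇒coalitionCount≥2 {u} {y} u∉F y∉F uy ext
    with s , s≢u , us ← nonFull⇒nonNeighbour u∉F
    = partition , blockWithSingletons-isCPartition s∈S u∉S u∉F coalition
    , coalitionCount≥2 partition (index-∈≢∉ s∈S u∉S) (index-∈≢∉ s∈S y∉S) (u≢y ∘ index-∉-injective u∉S y∉S)
        (blockWithSingletons-coalition s∈S u∉S (coalition u∉S u∉F))
        (blockWithSingletons-coalition s∈S y∉S (coalition y∉S y∉F))
    where
    open BlockWithSingletons (nonNbhd u)
    s∈S : s ∈ nonNbhd u
    s∈S = ∈nonNbhd⁺ s≢u us
    u∉S : u ∉ nonNbhd u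
    u∉S u∈S = proj₁ (∈nonNbhd⁻ u∈S) refl
    y∉S : y ∉ nonNbhd u
    y∉S y∈S = ≡true⇒≢false uy (proj₂ (∈nonNbhd⁻ y∈S))
    u≢y : u ≢ y
    u≢y refl = ≡true⇒≢false uy (irrefl G u)
    ¬domS : ¬ Dominating G (nonNbhd u)
    ¬domS = undominated⇒nonDominating u∉S (λ z z∈S → nonAdj-sym (proj₂ (∈nonNbhd⁻ z∈S)))
    coalition : ∀ {v} → v ∉ nonNbhd u → v ∉ fullSet G → Coalition G (nonNbhd u) ⁅ v ⁆
    coalition {v} v∉S v∉F = coalition-with-⁅⁆ v∉S v∉F ¬domS (ext v v∉S)

  adjacentNonFull⇒coalitionCount≥2 : ∀ {u y} → u ∉ fullSet G → y ∉ fullSet G → Adj G u y →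
                                     ∃[ π ] (IsCPartition G π × 2 ≤ coalitionCount G π)
  adjacentNonFull⇒coalitionCount≥2 {u} = descend (<-wellFounded ∣ closedNbhd u ∣)
    where
    descend : ∀ {u y} → Acc _<ℕ_ ∣ closedNbhd u ∣ → u ∉ fullSet G → y ∉ fullSet G → Adj G u y →
              ∃[ π ] (IsCPartition G π × 2 ≤ coalitionCount G π)
    descend {u} (acc smaller) u∉F y∉F uy with all? (extensionDominates? (nonNbhd u))
    ... | yes ext = extensionsDominate⇒coalitionCount≥2 u∉F y∉F uy ext
    ... | no ¬ext with x , x∉F , xu , shrinks ← nonExtension⇒smallerNeighbour ¬ext =
      descend (smaller shrinks) x∉F u∉F xu

  independentNonFull⇒coalitionNumber1 : Independent G nonFull → Nonempty nonFull → IsCoalitionNumber G 1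
  independentNonFull⇒coalitionNumber1 ind (w , w∈W)
    with u , u≢w , wu ← nonFull⇒nonNeighbour (x∈∁p⇒x∉p w∈W)
    = ( partition , blockWithSingletons-isCPartition u∈S w∉S w∉F coalition
      , ≤-antisym (coalitionCount≤1 ind partition) count≥1)
    , λ π _ → coalitionCount≤1 ind π
    where
    S : Subset n
    S = ∁ (fullSet G ∪ ⁅ w ⁆)
    open BlockWithSingletons S
    w∉F : w ∉ fullSet G
    w∉F = x∈∁p⇒x∉p w∈W
    ∈S⁺ : ∀ {x} → x ∉ fullSet G → x ≢ w → x ∈ S
    ∈S⁺ x∉F x≢w = x∉p⇒x∈∁p (λ x∈ → [ x∉F , x≢w ∘ x∈⁅y⁆⇒x≡y w ]′ (x∈p∪q⁻ (fullSet G) ⁅ w ⁆ x∈))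
    S⊆nonFull : ∀ {x} → x ∈ S → x ∉ fullSet G
    S⊆nonFull x∈S = x∈∁p⇒x∉p x∈S ∘ x∈p∪q⁺ ∘ inj₁
    w∉S : w ∉ S
    w∉S w∈S = x∈∁p⇒x∉p w∈S (x∈p∪q⁺ (inj₂ (x∈⁅x⁆ w)))
    u∈S : u ∈ S
    u∈S = ∈S⁺ (nonNeighbour⇒nonFull u≢w wu) u≢w
    ¬domS : ¬ Dominating G S
    ¬domS = undominated⇒nonDominating w∉S (λ z z∈S → independentNonFull⇒nonAdj ind (S⊆nonFull z∈S) w∉F)
    domS∪⁅w⁆ : Dominating G (S ∪ ⁅ w ⁆)
    domS∪⁅w⁆ x x∉ with x ∈? fullSet G
    ... | yes x∈F = w , x∈p∪q⁺ (inj₂ (x∈⁅x⁆ w)) , adj-sym (full⇒adj x∈F (λ { refl → w∉F x∈F }))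
    ... | no x∉F with x ≟ᶠ w
    ...   | yes refl = contradiction (x∈p∪q⁺ (inj₂ (x∈⁅x⁆ w))) x∉
    ...   | no x≢w   = contradiction (x∈p∪q⁺ (inj₁ (∈S⁺ x∉F x≢w))) x∉
    coalition : ∀ {v} → v ∉ S → v ∉ fullSet G → Coalition G S ⁅ v ⁆
    coalition {v} v∉S v∉F with v ≟ᶠ w
    ... | yes refl = coalition-with-⁅⁆ w∉S w∉F ¬domS domS∪⁅w⁆
    ... | no v≢w   = contradiction (∈S⁺ v∉F v≢w) v∉S
    count≥1 : 1 ≤ coalitionCount G partition
    count≥1 = coalitionCount≥1 partition (index-∈≢∉ u∈S w∉S)
                (blockWithSingletons-coalition u∈S w∉S (coalition w∉S w∉F))

  coalitionNumber1⇒independentNonFull : IsCoalitionNumber G 1 → Independent G nonFull × Nonempty nonFull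
  coalitionNumber1⇒independentNonFull ((π , _ , count≡1) , maximal)
    with (i , _) , p∈ ← ∈-length⇒member (coalitionPairs G π) (subst (1 ≤_) (sym count≡1) (s≤s z≤n))
    with _ , (_ , ¬domi , _) ← coalitionPairs-sound π p∈
    with v , v↦i ← nonempty π i
    = independent , v , x∉p⇒x∈∁p (nonDominating⇒nonFull ¬domi (from (∈block⇔ π) v↦i))
    where
    independent : Independent G nonFull
    independent a b a∈W b∈W = ¬-not λ ab →
      let π′ , isCP , count≥2 = adjacentNonFull⇒coalitionCount≥2 (x∈∁p⇒x∉p a∈W) (x∈∁p⇒x∉p b∈W) ab
      in ≤⇒≯ (maximal π′ isCP) count≥2

  coalitionNumber1⇔independentNonFull : IsCoalitionNumber G 1 ⇔ (Independent G nonFull × Nonempty nonFull)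
  coalitionNumber1⇔independentNonFull = mk⇔ coalitionNumber1⇒independentNonFull
    (λ (ind , nonempty) → independentNonFull⇒coalitionNumber1 ind nonempty)

  independentNonFull⇒independenceNumber : Independent G nonFull → Nonempty nonFull →
                                          IsIndependenceNumber G ∣ nonFull ∣
  independentNonFull⇒independenceNumber ind (w , w∈W) = (nonFull , ind , refl) , bound
    where
    bound : ∀ T → Independent G T → ∣ T ∣ ≤ ∣ nonFull ∣
    bound T indT with independent⇒⊆⁅⁆⊎⊆nonFull indT
    ... | inj₁ (_ , T⊆⁅z⁆) = ≤-trans (p⊆⁅x⁆⇒∣p∣≤1 T⊆⁅z⁆) (x∈p⇒1≤∣p∣ w∈W)
    ... | inj₂ T⊆W        = p⊆q⇒∣p∣≤∣q∣ T⊆W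

  -- With at least two non-full vertices, a maximum independent set cannot contain a full vertex,
  -- so it lies inside nonFull and, having the same size, exhausts it.
  independenceNumber⇒independentNonFull : Fin n → IsIndependenceNumber G ∣ nonFull ∣ →
                                          Independent G nonFull × Nonempty nonFull
  independenceNumber⇒independentNonFull v ((T , indT , ∣T∣≡) , maximal)
    with w , w∈W ← 1≤∣p∣⇒Nonempty nonFull (subst (_≤ _) (∣⁅x⁆∣≡1 v) (maximal ⁅ v ⁆ (⁅⁆-independent v)))
    with u , u≢w , wu ← nonFull⇒nonNeighbour (x∈∁p⇒x∉p w∈W)
    with independent⇒⊆⁅⁆⊎⊆nonFull indT
  ... | inj₁ (_ , T⊆⁅z⁆) = contradiction 2≤∣W∣ (≤⇒≯ (subst (_≤ 1) ∣T∣≡ (p⊆⁅x⁆⇒∣p∣≤1 T⊆⁅z⁆)))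
    where
    2≤∣W∣ : 2 ≤ ∣ nonFull ∣
    2≤∣W∣ = x∈p∧y∈p∧x≢y⇒2≤∣p∣ w∈W (x∉p⇒x∈∁p (nonNeighbour⇒nonFull u≢w wu)) u≢w
  ... | inj₂ T⊆W = (λ a b a∈W b∈W → indT a b (W⊆T a∈W) (W⊆T b∈W)) , w , w∈W
    where
    W⊆T : nonFull ⊆ T
    W⊆T {a} a∈W with a ∈? T
    ... | yes a∈T = a∈T
    ... | no a∉T  = ⊥-elim (<-irrefl ∣T∣≡ (p⊂q⇒∣p∣<∣q∣ (T⊆W , a , a∈W , a∉T)))

  independenceNumber⇔independentNonFull : Fin n → IsIndependenceNumber G ∣ nonFull ∣ ⇔
                                                   (Independent G nonFull × Nonempty nonFull)
  independenceNumber⇔independentNonFull v = mk⇔ (independenceNumber⇒independentNonFull v)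
    (λ (ind , nonempty) → independentNonFull⇒independenceNumber ind nonempty)

mainTheorem3 : (n : ℕ) → 1 ≤ n → (G : Graph n) → (f : ℕ) → numFull G ≡ f →
                 (IsCoalitionNumber G 1 ⇔ IsIndependenceNumber G (n ∸ f))
mainTheorem3 n 1≤n G f refl =
  subst (λ m → IsCoalitionNumber G 1 ⇔ IsIndependenceNumber G m) (∣∁p∣≡n∸∣p∣ (fullSet G))
    (⇔-trans (coalitionNumber1⇔independentNonFull G)
             (⇔-sym (independenceNumber⇔independentNonFull G (fromℕ< 1≤n))))
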